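{- Let $Z$ be a set, $\mathcal{Y}\subseteq\mathcal{P}(Z)$, $\mu:\mathcal{Y}\to\mathcal{P}(Z)$, and let $A,X,U,U',Y$ and all $A_i$ ($i\in I$) range over $\mathcal{Y}$. (1) If $\mu$ satisfies $(\mu\subseteq)$ and (HU), then $\mu$ satisfies (1.1) $(\mu PR)$ and (1.2) $(\mu Cum)$. (2) If $\mu$ satisfies $(\mu\subseteq)$ and (HU), and $\mathcal{Y}$ satisfies $(\cup)$, then $\mu$ satisfies (HUx). (3) If $\mu$ satisfies $(\mu\subseteq)$ and $(\mu PR)$, then: (3.1) if $A=\bigcup\{A_i:i\in I\}$ then $\mu(A)\subseteq\bigcup\{\mu(A_i):i\in I\}$; (3.2) $U\subseteq H(U)$, and $U\subseteq U'$ implies $H(U)\subseteq H(U')$; (3.3) if $U\cup Y\in\mathcal{Y}$, then $\mu(U\cup Y)-H(U)\subseteq\mu(Y)$. (4) If $\mathcal{Y}$ satisfies $(\cup)$ and $\mu$ satisfies $(\mu\subseteq)$, $(\mu PR)$, $(\mu Cum)$, then: (4.1) $H(U)=H(U)_1$; (4.2) if $U\subseteq A$ and $\mu(A)\subseteq H(U)$ then $\mu(A)\subseteq U$; (4.3) if $\mu(Y)\subseteq H(U)$ then $Y\subseteq H(U)$ and $\mu(U\cup Y)=\mu(U)$; (4.4) if $x\in\mu(U)$ and $x\in Y-\mu(Y)$ then $Y\not\subseteq H(U)$ (and thus (HU) holds); (4.5) if $Y\not\subseteq H(U)$ then $\mu(U\cup Y)\not\subseteq H(U)$. (5) If $\mathcal{Y}$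 satisfies $(\cup)$ and $\mu$ satisfies $(\mu\subseteq)$ and (HU), then (5.1)–(5.5), identical to (4.1)–(4.5) respectively (except that in (5.4) the parenthetical remark is omitted), hold.
   Context: Properties: $(\mu\subseteq)$: $\mu(X)\subseteq X$; $(\mu PR)$: $X\subseteq Y\Rightarrow\mu(Y)\cap X\subseteq\mu(X)$; $(\mu Cum)$: $\mu(X)\subseteq Y\subseteq X\Rightarrow\mu(X)=\mu(Y)$; $(\cup)$: $\mathcal{Y}$ is closed under finite unions (all sets in $\mathcal{Y}$). For $U\in\mathcal{Y}$: $H(U)_0:=U$; $H(U)_{\alpha+1}:=H(U)_\alpha\cup\bigcup\{X\in\mathcal{Y}:\mu(X)\subseteq H(U)_\alpha\}$; $H(U)_\lambda:=\bigcup_{\alpha<\lambda}H(U)_\alpha$ for limit $\lambda$; $H(U):=\bigcup_\alpha H(U)_\alpha$ over all ordinals. (HU): for all $U,Y\in\mathcal{Y}$, $x\in Z$: if $x\in\mu(U)$ and $x\in Y-\mu(Y)$ then $\mu(Y)\not\subseteq H(U)$. For $U\in\mathcal{Y}$, $x\in Z$: $H(U,x)_0:=U$; $H(U,x)_{\alpha+1}:=H(U,x)_\alpha\cup\bigcup\{X\in\mathcal{Y}:x\in X,\ \mu(X)\subseteq H(U,x)_\alpha\}$; unions at limits; $H(U,x):=\bigcup_\alpha H(U,x)_\alpha$. (HUx): for all $U,Y\in\mathcal{Y}$, $x\in Z$: if $x\in\mu(U)$ and $x\in Y-\mu(Y)$ then $\mu(Y)\not\subseteq H(U,x)$. -}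

module Defs where

open import Level using (0ℓ) renaming (suc to lsuc)
open import Data.Product using (Σ; _×_; ∃)
open import Data.Sum using (_⊎_)
open import Relation.Nullary using (¬_)
open import Relation.Unary using (Pred; _∈_; _∉_; _⊆_; _≐_; _∪_; _∩_)

Sub : Set → Set₁
Sub Z = Pred Z 0ℓ

-- The setting: a set Z, a family 𝒴 ⊆ 𝒫(Z), and μ : 𝒴 → 𝒫(Z).
-- μ is given as a total function on subsets; only its values on
-- members of 𝒴 are ever used.  Since subsets are predicates, we record
-- the set-theoretic facts that membership in 𝒴 and the value of μ only
-- depend on the extension of a subset (automatic in set theory).
record Framework : Set₂ where
  field
    Z     : Set
    𝒴     : Pred (Sub Z) 0ℓ
    μ     : Sub Z → Sub Z
    𝒴-ext : ∀ {X X′ : Sub Z} → X ≐ X′ → 𝒴 X → 𝒴 X′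
    μ-ext : ∀ {X X′ : Sub Z} → 𝒴 X → X ≐ X′ → μ X ≐ μ X′

module Props (F : Framework) where
  open Framework F

  μ⊆ : Set₁
  μ⊆ = ∀ (X : Sub Z) → 𝒴 X → μ X ⊆ X

  μPR : Set₁
  μPR = ∀ (X Y : Sub Z) → 𝒴 X → 𝒴 Y → X ⊆ Y → (μ Y ∩ X) ⊆ μ X

  μCum : Set₁
  μCum = ∀ (X Y : Sub Z) → 𝒴 X → 𝒴 Y → μ X ⊆ Y → Y ⊆ X → μ X ≐ μ Y

  ∪-closed : Set₁
  ∪-closed = ∀ (X Y : Sub Z) → 𝒴 X → 𝒴 Y → 𝒴 (X ∪ Y)

  -- H(U): the union over all ordinals of the stages H(U)_α, i.e. the
  -- least set containing U and containing every X ∈ 𝒴 with μ(X) ⊆ H(U).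
  data H (U : Sub Z) : Pred Z (lsuc 0ℓ) where
    base : ∀ {z} → z ∈ U → z ∈ H U
    step : ∀ {z} (X : Sub Z) → 𝒴 X → μ X ⊆ H U → z ∈ X → z ∈ H U

  H₁ : Sub Z → Pred Z (lsuc 0ℓ)
  H₁ U z = z ∈ U ⊎ Σ (Sub Z) (λ X → 𝒴 X × μ X ⊆ U × z ∈ X)

  -- H(U,x): least set containing U and every X ∈ 𝒴 with x ∈ X and
  -- μ(X) ⊆ H(U,x)  (union over all ordinals of the stages H(U,x)_α).
  data Hx (U : Sub Z) (x : Z) : Pred Z (lsuc 0ℓ) where
    base : ∀ {z} → z ∈ U → z ∈ Hx U x
    step : ∀ {z} (X : Sub Z) → 𝒴 X → x ∈ X → μ X ⊆ Hx U x → z ∈ X → z ∈ Hx U x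

  HU : Set₁
  HU = ∀ (U Y : Sub Z) (x : Z) → 𝒴 U → 𝒴 Y →
       x ∈ μ U → x ∈ Y → x ∉ μ Y → ¬ (μ Y ⊆ H U)

  HUx : Set₁
  HUx = ∀ (U Y : Sub Z) (x : Z) → 𝒴 U → 𝒴 Y →
        x ∈ μ U → x ∈ Y → x ∉ μ Y → ¬ (μ Y ⊆ Hx U x)

{-# OPTIONS --safe #-}

-- For (1), (HU) is only needed when μ Y ⊆ U, where it says (classically)
-- μ U ∩ Y ⊆ μ Y; (μPR) and both halves of (μCum) are instances of this.
-- (2) holds because H(U,x) ⊆ H(U).  The core of (4): if μ X ⊆ U ⊆ A then
-- μ(A ∪ X) = μ A by (μCum), hence μ A ∩ X ⊆ μ X ⊆ U by (μPR).  Taking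
-- A = X ∪ U shows that every X entering H(U) at a later stage already enters
-- at stage 1, and (4.2)-(4.5) follow from H(U) = H(U)₁.  (5) is (4) after (1).
module Submission where

open import Defs
open import Level using (0ℓ; _⊔_; Lift; lift; lower) renaming (suc to lsuc)
open import Data.Product using (_×_; _,_)
open import Data.Sum using (inj₁; inj₂; [_,_])
open import Function using (_∘_)
open import Relation.Nullary using (¬_; contradiction)
open import Relation.Unary using (_∈_; _∉_; _⊆_; _≐_; _∪_; _∩_; _∖_; ⋃)
open import Axiom.ExcludedMiddle using (ExcludedMiddle)
open import Axiom.DoubleNegationElimination using (DoubleNegationElimination; em⇒dne)

dne-lower : ∀ {a} b → DoubleNegationElimination (a ⊔ b) → DoubleNegationElimination a
dne-lower b dne ¬¬p = lower (dne {Lift b _} λ ¬lp → ¬¬p (¬lp ∘ lift))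

module Hull (F : Framework) where
  open Framework F
  open Props F

  H-mono : ∀ {U U′ : Sub Z} → U ⊆ U′ → H U ⊆ H U′
  H-mono U⊆U′ (base u)            = base (U⊆U′ u)
  H-mono U⊆U′ (step X 𝒴X μX⊆H z) = step X 𝒴X (H-mono U⊆U′ ∘ μX⊆H) z

  Hx⊆H : ∀ {U x} → Hx U x ⊆ H U
  Hx⊆H (base u)              = base u
  Hx⊆H (step X 𝒴X _ μX⊆H z) = step X 𝒴X (Hx⊆H ∘ μX⊆H) z

  HU⇒HUx : HU → HUx
  HU⇒HUx hu U Y x 𝒴U 𝒴Y x∈μU x∈Y x∉μY μY⊆Hx =
    hu U Y x 𝒴U 𝒴Y x∈μU x∈Y x∉μY (Hx⊆H ∘ μY⊆Hx)

  H₁⊆H : ∀ {U} → H₁ U ⊆ H U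
  H₁⊆H (inj₁ u)                   = base u
  H₁⊆H (inj₂ (X , 𝒴X , μX⊆U , z)) = step X 𝒴X (base ∘ μX⊆U) z

  module _ (dne : DoubleNegationElimination 0ℓ) (hu : HU) where

    μ∩⊆μ : ∀ {U Y : Sub Z} → 𝒴 U → 𝒴 Y → μ Y ⊆ U → (μ U ∩ Y) ⊆ μ Y
    μ∩⊆μ {U} {Y} 𝒴U 𝒴Y μY⊆U {x} (x∈μU , x∈Y) =
      dne λ x∉μY → hu U Y x 𝒴U 𝒴Y x∈μU x∈Y x∉μY (base ∘ μY⊆U)

    module _ (sub : μ⊆) where

      HU⇒μPR : μPR
      HU⇒μPR X Y 𝒴X 𝒴Y X⊆Y = μ∩⊆μ 𝒴Y 𝒴X (X⊆Y ∘ sub X 𝒴X)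

      HU⇒μCum : μCum
      HU⇒μCum X Y 𝒴X 𝒴Y μX⊆Y Y⊆X =
          (λ x∈μX → μ∩⊆μ 𝒴X 𝒴Y (Y⊆X ∘ sub Y 𝒴Y) (x∈μX , μX⊆Y x∈μX))
        , (λ x∈μY → μ∩⊆μ 𝒴Y 𝒴X μX⊆Y (x∈μY , Y⊆X (sub Y 𝒴Y x∈μY)))

  module _ (sub : μ⊆) (pr : μPR) where

    μ-⋃-⊆ : ∀ (I : Set₁) (As : I → Sub Z) (A : Sub Z) → 𝒴 A → (∀ i → 𝒴 (As i)) →
            A ≐ ⋃ I As → μ A ⊆ ⋃ I (λ i → μ (As i))
    μ-⋃-⊆ I As A 𝒴A 𝒴As (A⊆⋃ , ⋃⊆A) x∈μA =
      let (i , x∈Aᵢ) = A⊆⋃ (sub A 𝒴A x∈μA)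
      in  i , pr (As i) A (𝒴As i) 𝒴A (⋃⊆A ∘ (i ,_)) (x∈μA , x∈Aᵢ)

    μ∪∖H⊆μ : ∀ (U Y : Sub Z) → 𝒴 U → 𝒴 Y → 𝒴 (U ∪ Y) → (μ (U ∪ Y) ∖ H U) ⊆ μ Y
    μ∪∖H⊆μ U Y _ 𝒴Y 𝒴U∪Y (x∈μ , x∉H) =
      [ (λ x∈U → contradiction (base x∈U) x∉H)
      , (λ x∈Y → pr Y (U ∪ Y) 𝒴Y 𝒴U∪Y inj₂ (x∈μ , x∈Y)) ] (sub (U ∪ Y) 𝒴U∪Y x∈μ)

  module Cumulative (uc : ∪-closed) (sub : μ⊆) (pr : μPR) (cum : μCum) where

    μ∪≐μ : ∀ {A X : Sub Z} → 𝒴 A → 𝒴 X → μ X ⊆ A → μ (A ∪ X) ≐ μ A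
    μ∪≐μ {A} {X} 𝒴A 𝒴X μX⊆A = cum (A ∪ X) A 𝒴A∪X 𝒴A μA∪X⊆A inj₁
      where
      𝒴A∪X : 𝒴 (A ∪ X)
      𝒴A∪X = uc A X 𝒴A 𝒴X
      μA∪X⊆A : μ (A ∪ X) ⊆ A
      μA∪X⊆A y∈μ = [ (λ y∈A → y∈A) , (λ y∈X → μX⊆A (pr X (A ∪ X) 𝒴X 𝒴A∪X inj₂ (y∈μ , y∈X))) ]
                     (sub (A ∪ X) 𝒴A∪X y∈μ)

    μ∪≐μ⇒μ∩⊆μ : ∀ {A X : Sub Z} → 𝒴 A → 𝒴 X → μ (A ∪ X) ≐ μ A → (μ A ∩ X) ⊆ μ X
    μ∪≐μ⇒μ∩⊆μ {A} {X} 𝒴A 𝒴X (_ , μA⊆μA∪X) (x∈μA , x∈X) =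
      pr X (A ∪ X) 𝒴X (uc A X 𝒴A 𝒴X) inj₂ (μA⊆μA∪X x∈μA , x∈X)

    μ∩⊆ : ∀ {U A X : Sub Z} → 𝒴 A → 𝒴 X → U ⊆ A → μ X ⊆ U → (μ A ∩ X) ⊆ U
    μ∩⊆ 𝒴A 𝒴X U⊆A μX⊆U = μX⊆U ∘ μ∪≐μ⇒μ∩⊆μ 𝒴A 𝒴X (μ∪≐μ 𝒴A 𝒴X (U⊆A ∘ μX⊆U))

    μ⊆H₁⇒μ⊆ : ∀ {U A : Sub Z} → 𝒴 A → U ⊆ A → μ A ⊆ H₁ U → μ A ⊆ U
    μ⊆H₁⇒μ⊆ 𝒴A U⊆A μA⊆H₁ x∈μA with μA⊆H₁ x∈μA
    ... | inj₁ x∈U                  = x∈U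
    ... | inj₂ (X , 𝒴X , μX⊆U , x∈X) = μ∩⊆ 𝒴A 𝒴X U⊆A μX⊆U (x∈μA , x∈X)

    H⊆H₁ : ∀ {U} → 𝒴 U → H U ⊆ H₁ U
    H⊆H₁ 𝒴U (base u) = inj₁ u
    H⊆H₁ {U} 𝒴U (step X 𝒴X μX⊆H z) = inj₂ (X ∪ U , 𝒴X∪U , μ⊆H₁⇒μ⊆ 𝒴X∪U inj₂ μX∪U⊆H₁ , inj₁ z)
      where
      𝒴X∪U : 𝒴 (X ∪ U)
      𝒴X∪U = uc X U 𝒴X 𝒴U
      μX∪U⊆H₁ : μ (X ∪ U) ⊆ H₁ U
      μX∪U⊆H₁ y∈μ = [ (λ y∈X → H⊆H₁ 𝒴U (μX⊆H (pr X (X ∪ U) 𝒴X 𝒴X∪U inj₁ (y∈μ , y∈X)))) , inj₁ ]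
                      (sub (X ∪ U) 𝒴X∪U y∈μ)

    H≐H₁ : ∀ (U : Sub Z) → 𝒴 U → H U ≐ H₁ U
    H≐H₁ U 𝒴U = H⊆H₁ 𝒴U , H₁⊆H

    μ⊆H⇒μ⊆ : ∀ (U A : Sub Z) → 𝒴 U → 𝒴 A → U ⊆ A → μ A ⊆ H U → μ A ⊆ U
    μ⊆H⇒μ⊆ U A 𝒴U 𝒴A U⊆A μA⊆H = μ⊆H₁⇒μ⊆ 𝒴A U⊆A (H⊆H₁ 𝒴U ∘ μA⊆H)

    ⊆H⇒μ∪≐μ : ∀ {U Y : Sub Z} → 𝒴 U → 𝒴 Y → Y ⊆ H U → μ (U ∪ Y) ≐ μ U
    ⊆H⇒μ∪≐μ {U} {Y} 𝒴U 𝒴Y Y⊆H = cum (U ∪ Y) U 𝒴U∪Y 𝒴U μU∪Y⊆U inj₁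
      where
      𝒴U∪Y : 𝒴 (U ∪ Y)
      𝒴U∪Y = uc U Y 𝒴U 𝒴Y
      μU∪Y⊆U : μ (U ∪ Y) ⊆ U
      μU∪Y⊆U = μ⊆H⇒μ⊆ U (U ∪ Y) 𝒴U 𝒴U∪Y inj₁ ([ base , Y⊆H ] ∘ sub (U ∪ Y) 𝒴U∪Y)

    μ⊆H⇒⊆H×μ∪≐μ : ∀ (U Y : Sub Z) → 𝒴 U → 𝒴 Y → μ Y ⊆ H U → (Y ⊆ H U) × (μ (U ∪ Y) ≐ μ U)
    μ⊆H⇒⊆H×μ∪≐μ U Y 𝒴U 𝒴Y μY⊆H = step Y 𝒴Y μY⊆H , ⊆H⇒μ∪≐μ 𝒴U 𝒴Y (step Y 𝒴Y μY⊆H)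

    μ∖μ⇒⊈H : ∀ (U Y : Sub Z) (x : Z) → 𝒴 U → 𝒴 Y → x ∈ μ U → x ∈ Y → x ∉ μ Y → ¬ (Y ⊆ H U)
    μ∖μ⇒⊈H U Y x 𝒴U 𝒴Y x∈μU x∈Y x∉μY Y⊆H =
      x∉μY (μ∪≐μ⇒μ∩⊆μ 𝒴U 𝒴Y (⊆H⇒μ∪≐μ 𝒴U 𝒴Y Y⊆H) (x∈μU , x∈Y))

    μCum⇒HU : HU
    μCum⇒HU U Y x 𝒴U 𝒴Y x∈μU x∈Y x∉μY μY⊆H = μ∖μ⇒⊈H U Y x 𝒴U 𝒴Y x∈μU x∈Y x∉μY (step Y 𝒴Y μY⊆H)

    ⊈H⇒μ∪⊈H : ∀ (U Y : Sub Z) → 𝒴 U → 𝒴 Y → ¬ (Y ⊆ H U) → ¬ (μ (U ∪ Y) ⊆ H U)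
    ⊈H⇒μ∪⊈H U Y 𝒴U 𝒴Y Y⊈H μ⊆H = Y⊈H (λ y∈Y → step (U ∪ Y) (uc U Y 𝒴U 𝒴Y) μ⊆H (inj₂ y∈Y))

fact2p2 : ExcludedMiddle (lsuc 0ℓ) → (F : Framework) →
  let open Framework F
      open Props F
  in
  -- (1)
  (μ⊆ → HU → μPR × μCum)
  -- (2)
  × (μ⊆ → HU → ∪-closed → HUx)
  -- (3)
  × (μ⊆ → μPR →
      -- (3.1)
      (∀ (I : Set₁) (As : I → Sub Z) (A : Sub Z) → 𝒴 A → (∀ i → 𝒴 (As i)) →
         A ≐ ⋃ I As → μ A ⊆ ⋃ I (λ i → μ (As i)))
      -- (3.2)
      × (∀ (U : Sub Z) → 𝒴 U → U ⊆ H U)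
      × (∀ (U U′ : Sub Z) → 𝒴 U → 𝒴 U′ → U ⊆ U′ → H U ⊆ H U′)
      -- (3.3)
      × (∀ (U Y : Sub Z) → 𝒴 U → 𝒴 Y → 𝒴 (U ∪ Y) → (μ (U ∪ Y) ∖ H U) ⊆ μ Y))
  -- (4)
  × (∪-closed → μ⊆ → μPR → μCum →
      -- (4.1)
      (∀ (U : Sub Z) → 𝒴 U → H U ≐ H₁ U)
      -- (4.2)
      × (∀ (U A : Sub Z) → 𝒴 U → 𝒴 A → U ⊆ A → μ A ⊆ H U → μ A ⊆ U)
      -- (4.3)
      × (∀ (U Y : Sub Z) → 𝒴 U → 𝒴 Y → μ Y ⊆ H U → (Y ⊆ H U) × (μ (U ∪ Y) ≐ μ U))
      -- (4.4)
      × ((∀ (U Y : Sub Z) (x : Z) → 𝒴 U → 𝒴 Y → x ∈ μ U → x ∈ Y → x ∉ μ Y → ¬ (Y ⊆ H U)) × HU)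
      -- (4.5)
      × (∀ (U Y : Sub Z) → 𝒴 U → 𝒴 Y → ¬ (Y ⊆ H U) → ¬ (μ (U ∪ Y) ⊆ H U)))
  -- (5)
  × (∪-closed → μ⊆ → HU →
      -- (5.1)
      (∀ (U : Sub Z) → 𝒴 U → H U ≐ H₁ U)
      -- (5.2)
      × (∀ (U A : Sub Z) → 𝒴 U → 𝒴 A → U ⊆ A → μ A ⊆ H U → μ A ⊆ U)
      -- (5.3)
      × (∀ (U Y : Sub Z) → 𝒴 U → 𝒴 Y → μ Y ⊆ H U → (Y ⊆ H U) × (μ (U ∪ Y) ≐ μ U))
      -- (5.4)
      × (∀ (U Y : Sub Z) (x : Z) → 𝒴 U → 𝒴 Y → x ∈ μ U → x ∈ Y → x ∉ μ Y → ¬ (Y ⊆ H U))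
      -- (5.5)
      × (∀ (U Y : Sub Z) → 𝒴 U → 𝒴 Y → ¬ (Y ⊆ H U) → ¬ (μ (U ∪ Y) ⊆ H U)))
fact2p2 em F =
    (λ sub hu → HU⇒μPR dne hu sub , HU⇒μCum dne hu sub)
  , (λ _ hu _ → HU⇒HUx hu)
  , (λ sub pr → μ-⋃-⊆ sub pr , (λ _ _ → base) , (λ _ _ _ _ → H-mono) , μ∪∖H⊆μ sub pr)
  , (λ uc sub pr cum → let open Cumulative uc sub pr cum in
       H≐H₁ , μ⊆H⇒μ⊆ , μ⊆H⇒⊆H×μ∪≐μ , (μ∖μ⇒⊈H , μCum⇒HU) , ⊈H⇒μ∪⊈H)
  , (λ uc sub hu → let open Cumulative uc sub (HU⇒μPR dne hu sub) (HU⇒μCum dne hu sub) in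
       H≐H₁ , μ⊆H⇒μ⊆ , μ⊆H⇒⊆H×μ∪≐μ , μ∖μ⇒⊈H , ⊈H⇒μ∪⊈H)
  where
  open Hull F
  open Props F using (base)
  dne : DoubleNegationElimination 0ℓ
  dne = dne-lower (lsuc 0ℓ) (em⇒dne em)
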